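{- For every tree $T$ of order $n$, $C_2(T)\le \frac{n}{2}+1$.
   Context: All graphs are finite, simple and undirected. A set $S\subseteq V(G)$ is a $2$-dominating set of $G$ if every vertex of $V(G)\setminus S$ has at least $2$ neighbours in $S$. Two sets $U_1,U_2\subseteq V(G)$ form a $2$-coalition if neither $U_1$ nor $U_2$ is a $2$-dominating set of $G$, but $U_1\cup U_2$ is. A $2$-coalition partition of $G$ is a partition $\Theta$ of $V(G)$ into nonempty sets such that every set of $\Theta$ either is a $2$-dominating set of $G$ with exactly $2$ elements, or forms a $2$-coalition with some other set of $\Theta$. The $2$-coalition number $C_2(G)$ is the maximum number of sets in a $2$-coalition partition of $G$. -}

module Defs where

open import Data.Nat using (ℕ; zero; suc; _+_; _≤_; _∸_)
open import Data.Bool using (Bool; true; false; T; if_then_else_; _∨_)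
open import Data.Fin using (Fin)
open import Data.List using (List; []; _∷_; map; allFin; length)
open import Data.Nat.ListAction using (sum)
open import Data.List.Relation.Unary.Unique.Propositional using (Unique)
open import Data.List.Relation.Unary.Linked using (Linked)
open import Data.Product using (Σ; _×_; ∃-syntax)
open import Data.Sum using (_⊎_)
open import Relation.Nullary using (¬_)
open import Relation.Binary.PropositionalEquality using (_≡_)

record Graph (n : ℕ) : Set where
  field
    adj   : Fin n → Fin n → Bool
    sym   : ∀ u v → adj u v ≡ adj v u
    irrefl : ∀ v → adj v v ≡ false

open Graph public

Adj : ∀ {n} → Graph n → Fin n → Fin n → Set
Adj G u v = T (adj G u v)

data Walk {n : ℕ} (G : Graph n) : Fin n → Fin n → Set where
  here : ∀ {v} → Walk G v v
  step : ∀ {u w v} → Adj G u w → Walk G w v → Walk G u v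

Connected : ∀ {n} → Graph n → Set
Connected G = ∀ u v → Walk G u v

lastOf : ∀ {n} → Fin n → List (Fin n) → Fin n
lastOf x []       = x
lastOf x (y ∷ ys) = lastOf y ys

-- a cycle: distinct vertices x, x₁, …, x_k (k+1 ≥ 3), consecutive ones adjacent,
-- and the last adjacent to the first
IsCycle : ∀ {n} → Graph n → Fin n → List (Fin n) → Set
IsCycle G x xs =
  Unique (x ∷ xs) × (2 ≤ length xs) × Linked (Adj G) (x ∷ xs) × Adj G (lastOf x xs) x

Acyclic : ∀ {n} → Graph n → Set
Acyclic G = ∀ x xs → ¬ IsCycle G x xs

IsTree : ∀ {n} → Graph n → Set
IsTree {n} G = (1 ≤ n) × Connected G × Acyclic G

VSet : ℕ → Set
VSet n = Fin n → Bool

count : ∀ {n} → (Fin n → Bool) → ℕ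
count {n} p = sum (map (λ i → if p i then 1 else 0) (allFin n))

_∪_ : ∀ {n} → VSet n → VSet n → VSet n
(S ∪ U) v = S v ∨ U v

TwoDominating : ∀ {n} → Graph n → VSet n → Set
TwoDominating G S =
  ∀ v → S v ≡ false → 2 ≤ count (λ u → if adj G v u then S u else false)

TwoCoalition : ∀ {n} → Graph n → VSet n → VSet n → Set
TwoCoalition G U₁ U₂ =
  ¬ TwoDominating G U₁ × ¬ TwoDominating G U₂ × TwoDominating G (U₁ ∪ U₂)

open import Data.Fin using (_≟_)
open import Relation.Nullary using (does)

classOf : ∀ {n k} → (Fin n → Fin k) → Fin k → VSet n
classOf f i v = does (f v ≟ i)

-- a 2-coalition partition of G into k nonempty sets, given as a labelling f
-- (the sets are the fibres of f; surjectivity = all k sets are nonempty)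
record TwoCoalitionPartition {n : ℕ} (G : Graph n) (k : ℕ) : Set where
  field
    label    : Fin n → Fin k
    nonempty : ∀ i → ∃[ v ] label v ≡ i
    good     : ∀ i →
      (TwoDominating G (classOf label i) × count (classOf label i) ≡ 2)
      ⊎ (∃[ j ] (¬ (j ≡ i) × TwoCoalition G (classOf label i) (classOf label j)))

module Submission where

-- Root the tree at a vertex r of a 2-dominating set S. A vertex outside S has at least two
-- neighbours in S, at most one of them its parent, so it has a child in S; choosing such a
-- child is injective, and the chosen children have their parent outside S, so they miss r
-- and the lower end of every edge inside S. Hence |S| ≥ |V∖S| + 1, and |S| ≥ |V∖S| + 2 when
-- S spans an edge; in particular two disjoint 2-dominating sets cannot both exist.
--
-- In a 2-coalition partition with k classes, look at one class. If it is a 2-dominating pair,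
-- at most one vertex, hence at most one other class, lies outside it, so k ≤ 2 ≤ n.
-- Otherwise its union S with a partner is 2-dominating and the other k − 2 classes lie in
-- V∖S, so n = |S| + |V∖S| ≥ 2(k − 2) + 1. Equality forces S to be independent,
-- |S| = |V∖S| + 1 and the other classes to be singletons {x}. Such a class has no partner:
-- not a class inside V∖S by disjointness, and not a class of S, since a vertex of the other
-- class of S would have x as its only neighbour in the union.

open import Defs hiding (sym)
open import Data.Bool using (Bool; true; false; T; not; _∧_; _∨_; if_then_else_)
open import Data.Bool.Properties using (T-∧; T-∨; T-≡; T-not-≡; ∧-identityʳ)
open import Data.Empty using (⊥; ⊥-elim)
open import Data.Fin using (Fin; zero; suc; _≟_)
open import Data.List using (List; []; _∷_; length; tabulate; allFin)
open import Data.List.Properties using (map-tabulate; map-cong)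
open import Data.List.Membership.Propositional using (_∈_; _∉_)
import Data.List.Membership.DecPropositional as DecMembership
open import Data.List.Relation.Binary.Subset.Propositional using () renaming (_⊆_ to _⊆ˡ_)
open import Data.List.Relation.Unary.All using ([]; _∷_)
open import Data.List.Relation.Unary.All.Properties using (¬Any⇒All¬; All¬⇒¬Any)
open import Data.List.Relation.Unary.AllPairs using ([]; _∷_)
open import Data.List.Relation.Unary.Any using (here; there)
open import Data.List.Relation.Unary.Linked using (Linked; [-]; _∷_)
open import Data.List.Relation.Unary.Unique.Propositional using (Unique)
open import Data.Nat using (ℕ; zero; suc; _+_; _*_; _≤_; _≤?_; z≤n; s≤s)
open import Data.Nat.ListAction using (sum)
open import Data.Nat.Properties hiding (_≟_)
open import Data.Nat.Tactic.RingSolver using (solve-∀)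
open import Data.Product using (Σ; _×_; _,_; proj₁; proj₂; ∃-syntax)
open import Data.Sum using (_⊎_; inj₁; inj₂; [_,_]; map₁)
open import Data.Unit using (tt)
open import Function using (_∘_; id; Equivalence)
open import Relation.Nullary using (¬_; yes; no; does; contradiction)
open import Relation.Nullary.Decidable using (dec-true; dec-false)
open import Relation.Binary.PropositionalEquality using (_≡_; _≢_; refl; sym; trans; cong; subst)

open Equivalence using (to; from)

not-intro : ∀ {b} → (T b → ⊥) → T (not b)
not-intro {false} _ = tt
not-intro {true}  f = f tt

not-elim : ∀ {b} → T (not b) → T b → ⊥
not-elim {false} _ ()

not-∨-intro : ∀ {a b} → T (not a) → T (not b) → T (not (a ∨ b))
not-∨-intro {false} _ ¬b = ¬b

T-guard : ∀ {b x} → T (if b then x else false) → T b × T x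
T-guard {true} t = tt , t

_==_ : ∀ {n} → Fin n → Fin n → Bool
i == j = does (i ≟ j)

==⇒≡ : ∀ {n} {i j : Fin n} → T (i == j) → i ≡ j
==⇒≡ {i = i} {j} t with i ≟ j
... | yes i≡j = i≡j

≡⇒== : ∀ {n} {i j : Fin n} → i ≡ j → T (i == j)
≡⇒== {i = i} {j} i≡j = from T-≡ (dec-true (i ≟ j) i≡j)

≢⇒not== : ∀ {n} {i j : Fin n} → i ≢ j → T (not (i == j))
≢⇒not== {i = i} {j} i≢j = from T-not-≡ (dec-false (i ≟ j) i≢j)

_⊆_ : ∀ {n} → (Fin n → Bool) → (Fin n → Bool) → Set
p ⊆ q = ∀ i → T (p i) → T (q i)

∪-⊆ : ∀ {n} {p q r : Fin n → Bool} → p ⊆ r → q ⊆ r → (p ∪ q) ⊆ r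
∪-⊆ {p = p} p⊆r q⊆r i pq with to (T-∨ {p i}) pq
... | inj₁ pi = p⊆r i pi
... | inj₂ qi = q⊆r i qi

count-cong : ∀ {n} {p q : Fin n → Bool} → (∀ i → p i ≡ q i) → count p ≡ count q
count-cong {n} p≗q = cong sum (map-cong (λ i → cong (λ b → if b then 1 else 0) (p≗q i)) (allFin n))

count-suc : ∀ {n} (p : Fin (suc n) → Bool) → count p ≡ (if p zero then 1 else 0) + count (p ∘ suc)
count-suc {n} p =
  trans (as-sum p) (cong ((if p zero then 1 else 0) +_) (sym (as-sum {n} (p ∘ suc))))
  where
  as-sum : ∀ {m} (q : Fin m → Bool) → count q ≡ sum (tabulate (λ i → if q i then 1 else 0))
  as-sum {m} q = cong sum (map-tabulate {n = m} id (λ b → if q b then 1 else 0))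

count-all : ∀ {n} → count {n} (λ _ → true) ≡ n
count-all {zero}  = refl
count-all {suc n} = trans (count-suc {n} (λ _ → true)) (cong suc (count-all {n}))

count-mono : ∀ {n} {p q : Fin n → Bool} → p ⊆ q → count p ≤ count q
count-mono {zero}          _   = z≤n
count-mono {suc n} {p} {q} p⊆q rewrite count-suc p | count-suc q =
  +-mono-≤ (indicator-mono (p⊆q zero)) (count-mono (p⊆q ∘ suc))
  where
  indicator-mono : ∀ {a b} → (T a → T b) → (if a then 1 else 0) ≤ (if b then 1 else 0)
  indicator-mono {false}         _ = z≤n
  indicator-mono {true}  {true}  _ = ≤-refl
  indicator-mono {true}  {false} f = ⊥-elim (f tt)

count-split : ∀ {n} (p q : Fin n → Bool) →
  count (λ i → p i ∧ q i) + count (λ i → p i ∧ not (q i)) ≡ count p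
count-split {zero}  p q = refl
count-split {suc n} p q
  rewrite count-suc (λ i → p i ∧ q i) | count-suc (λ i → p i ∧ not (q i)) | count-suc p
  with p zero | q zero | count-split (p ∘ suc) (q ∘ suc)
... | false | _     | split = split
... | true  | true  | split = cong suc split
... | true  | false | split = trans (+-suc _ _) (cong suc split)

count-complement : ∀ {n} (p : Fin n → Bool) → count p + count (not ∘ p) ≡ n
count-complement p = trans (count-split (λ _ → true) p) count-all

count-remove : ∀ {n} (p : Fin n → Bool) {x} → T (p x) →
  count p ≡ suc (count (λ i → p i ∧ not (i == x)))
count-remove {suc n} p {zero} px
  rewrite count-suc p | count-suc (λ i → p i ∧ not (i == zero)) with p zero
... | true = cong suc (count-cong (λ i → sym (∧-identityʳ (p (suc i)))))
count-remove {suc n} p {suc x} px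
  rewrite count-suc p | count-suc (λ i → p i ∧ not (i == suc x)) | count-remove (p ∘ suc) px
  with p zero
... | false = refl
... | true  = refl

count-witness : ∀ {n} (p : Fin n → Bool) → 1 ≤ count p → ∃[ i ] T (p i)
count-witness {suc n} p 1≤count rewrite count-suc p with p zero in p₀
... | true  = zero , from T-≡ p₀
... | false = let (i , pi) = count-witness (p ∘ suc) 1≤count in suc i , pi

count-witness₂ : ∀ {n} (p : Fin n → Bool) → 2 ≤ count p →
  ∃[ i ] ∃[ j ] i ≢ j × T (p i) × T (p j)
count-witness₂ p 2≤count
  with i , pi ← count-witness p (≤-trans (s≤s z≤n) 2≤count)
  with j , pj∧j≢i ← count-witness _ (≤-pred (subst (2 ≤_) (count-remove p pi) 2≤count))
  with pj , j≢i ← to T-∧ pj∧j≢i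
  = i , j , (λ i≡j → not-elim j≢i (≡⇒== (sym i≡j))) , pi , pj

count-pos : ∀ {n} (p : Fin n → Bool) {x} → T (p x) → 1 ≤ count p
count-pos p px = subst (1 ≤_) (sym (count-remove p px)) (s≤s z≤n)

count-two : ∀ {n} (p : Fin n → Bool) {x y} → x ≢ y → T (p x) → T (p y) → 2 ≤ count p
count-two p {x} x≢y px py = subst (2 ≤_) (sym (count-remove p px))
  (s≤s (count-pos (λ i → p i ∧ not (i == x)) (from T-∧ (py , ≢⇒not== (x≢y ∘ sym)))))

count≤1 : ∀ {n} (p : Fin n → Bool) {x} → (∀ {i} → T (p i) → i ≡ x) → count p ≤ 1
count≤1 p only-x = ≮⇒≥ λ 2≤count →
  let (i , j , i≢j , pi , pj) = count-witness₂ p 2≤count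
  in i≢j (trans (only-x pi) (sym (only-x pj)))

count≤suc-remove : ∀ {n} (p : Fin n → Bool) x → count p ≤ suc (count (λ i → p i ∧ not (i == x)))
count≤suc-remove p x with p x in px
... | true  = ≤-reflexive (count-remove p (from T-≡ px))
... | false = m≤n⇒m≤1+n (count-mono λ i pi →
  from T-∧ (pi , ≢⇒not== {i = i} {x} λ { refl → subst T px pi }))

count-≤-image : ∀ {m n} (h : Fin m → Fin n) (P : Fin n → Bool) (Q : Fin m → Bool) →
  (∀ {a} → T (P a) → ∃[ b ] T (Q b) × h b ≡ a) → count P ≤ count Q
count-≤-image {zero} h P Q cover with count P ≤? 0
... | yes ≤0 = ≤0
... | no ≰0 with a , Pa ← count-witness P (≰⇒> ≰0) with () , _ ← cover Pa
count-≤-image {suc m} h P Q cover rewrite count-suc Q with Q zero in q₀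
... | false = count-≤-image (h ∘ suc) P (Q ∘ suc) cover′
  where
  cover′ : ∀ {a} → T (P a) → ∃[ b ] T (Q (suc b)) × h (suc b) ≡ a
  cover′ Pa with cover Pa
  ... | zero  , Q₀ , _  = ⊥-elim (subst T q₀ Q₀)
  ... | suc b , Qb , hb = b , Qb , hb
... | true =
  ≤-trans (count≤suc-remove P (h zero)) (s≤s (count-≤-image (h ∘ suc) _ (Q ∘ suc) cover′))
  where
  cover′ : ∀ {a} → T (P a ∧ not (a == h zero)) → ∃[ b ] T (Q (suc b)) × h (suc b) ≡ a
  cover′ Pa∧a≢h₀ with Pa , a≢h₀ ← to T-∧ Pa∧a≢h₀ with cover Pa
  ... | zero  , _  , refl = ⊥-elim (not-elim a≢h₀ (≡⇒== {i = h zero} refl))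
  ... | suc b , Qb , hb   = b , Qb , hb

adj-sym : ∀ {n} (G : Graph n) {u v} → Adj G u v → Adj G v u
adj-sym G {u} {v} = subst T (Graph.sym G u v)

adj-irrefl : ∀ {n} (G : Graph n) {v} → ¬ Adj G v v
adj-irrefl G {v} = subst T (irrefl G v)

module _ {n : ℕ} {G : Graph n} where
  open DecMembership (_≟_ {n}) using (_∈?_)

  vertices : ∀ {u v} → Walk G u v → List (Fin n)
  vertices {u} here       = u ∷ []
  vertices {u} (step _ p) = u ∷ vertices p

  start∈ : ∀ {u v} (p : Walk G u v) → u ∈ vertices p
  start∈ here       = here refl
  start∈ (step _ _) = here refl

  end∈ : ∀ {u v} (p : Walk G u v) → v ∈ vertices p
  end∈ here       = here refl
  end∈ (step _ p) = there (end∈ p)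

  _++ʷ_ : ∀ {u v w} → Walk G u v → Walk G v w → Walk G u w
  here     ++ʷ q = q
  step a p ++ʷ q = step a (p ++ʷ q)

  ∈-++ʷ⁻ : ∀ {u v w x} (p : Walk G u v) {q : Walk G v w} →
    x ∈ vertices (p ++ʷ q) → x ∈ vertices p ⊎ x ∈ vertices q
  ∈-++ʷ⁻ here       x∈q          = inj₂ x∈q
  ∈-++ʷ⁻ (step _ p) (here x≡u)   = inj₁ (here x≡u)
  ∈-++ʷ⁻ (step _ p) (there x∈pq) = map₁ there (∈-++ʷ⁻ p x∈pq)

  reverse : ∀ {u v} → Walk G u v → Walk G v u
  reverse here       = here
  reverse (step a p) = reverse p ++ʷ step (adj-sym G a) here

  ∈-reverse⁻ : ∀ {u v x} (p : Walk G u v) → x ∈ vertices (reverse p) → x ∈ vertices p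
  ∈-reverse⁻ here       x∈ = x∈
  ∈-reverse⁻ (step a p) x∈ with ∈-++ʷ⁻ (reverse p) x∈
  ... | inj₁ x∈p                = there (∈-reverse⁻ p x∈p)
  ... | inj₂ (here refl)         = there (start∈ p)
  ... | inj₂ (there (here x≡u))  = here x≡u

  suffix-from : ∀ {s t u} (p : Walk G s t) → u ∈ vertices p →
    Σ (Walk G u t) λ q → vertices q ⊆ˡ vertices p × (Unique (vertices p) → Unique (vertices q))
  suffix-from here       (here refl)  = here , id , id
  suffix-from (step a p) (here refl)  = step a p , id , id
  suffix-from (step _ p) (there u∈p) with q , q⊆p , uq ← suffix-from p u∈p =
    q , there ∘ q⊆p , λ { (_ ∷ up) → uq up }

  toPath : ∀ {s t} (p : Walk G s t) →
    Σ (Walk G s t) λ q → Unique (vertices q) × vertices q ⊆ˡ vertices p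
  toPath here = here , [] ∷ [] , id
  toPath {s} (step a p) with q , uq , q⊆p ← toPath p with s ∈? vertices q
  ... | yes s∈q with q′ , q′⊆q , uq′ ← suffix-from q s∈q = q′ , uq′ uq , there ∘ q⊆p ∘ q′⊆q
  ... | no s∉q  = step a q , ¬Any⇒All¬ _ s∉q ∷ uq ,
    λ { (here s≡) → here s≡ ; (there x∈q) → there (q⊆p x∈q) }

  vertices-linked : ∀ {u v} (p : Walk G u v) → Linked (Adj G) (vertices p)
  vertices-linked here                = [-]
  vertices-linked (step a here)       = a ∷ [-]
  vertices-linked (step a (step b p)) = a ∷ vertices-linked (step b p)

  lastOf-vertices : ∀ {u v} x (p : Walk G u v) → lastOf x (vertices p) ≡ v
  lastOf-vertices x here       = refl
  lastOf-vertices x (step _ p) = lastOf-vertices _ p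

  close-cycle : ∀ {v w₁ w₂} (p : Walk G w₁ w₂) → Unique (vertices p) → v ∉ vertices p →
    w₁ ≢ w₂ → Adj G v w₁ → Adj G w₂ v → IsCycle G v (vertices p)
  close-cycle here       _  _   w₁≢w₂ _   _   = contradiction refl w₁≢w₂
  close-cycle {v} (step a p) up v∉p _ vw₁ w₂v =
    ¬Any⇒All¬ _ v∉p ∷ up , s≤s (length≥1 p) , vw₁ ∷ vertices-linked (step a p) ,
    subst (λ x → Adj G x v) (sym (lastOf-vertices _ p)) w₂v
    where
    length≥1 : ∀ {u w} (q : Walk G u w) → 1 ≤ length (vertices q)
    length≥1 here       = s≤s z≤n
    length≥1 (step _ _) = s≤s z≤n

  no-detour : Acyclic G → ∀ {v w₁ w₂} → Adj G v w₁ → Adj G v w₂ → w₁ ≢ w₂ →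
    (p : Walk G w₁ w₂) → v ∉ vertices p → ⊥
  no-detour acyclic vw₁ vw₂ w₁≢w₂ p v∉p with q , uq , q⊆p ← toPath p =
    acyclic _ _ (close-cycle q uq (v∉p ∘ q⊆p) w₁≢w₂ vw₁ (adj-sym G vw₂))

  towards-unique : Acyclic G → ∀ {v w₁ w₂ r} → Adj G v w₁ → Adj G v w₂ →
    (p : Walk G w₁ r) → v ∉ vertices p → (q : Walk G w₂ r) → v ∉ vertices q → w₁ ≡ w₂
  towards-unique acyclic {w₁ = w₁} {w₂} vw₁ vw₂ p v∉p q v∉q with w₁ ≟ w₂
  ... | yes w₁≡w₂ = w₁≡w₂
  ... | no  w₁≢w₂ = ⊥-elim (no-detour acyclic vw₁ vw₂ w₁≢w₂ (p ++ʷ reverse q)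
                      ([ v∉p , v∉q ∘ ∈-reverse⁻ q ] ∘ ∈-++ʷ⁻ p))

record Rooting {n} (G : Graph n) (r : Fin n) : Set where
  field
    parent      : Fin n → Fin n
    parent-root : parent r ≡ r
    parent-edge : ∀ {u v} → Adj G u v → parent u ≡ v ⊎ parent v ≡ u

  parent-of-root-neighbour : ∀ {v} → Adj G r v → parent v ≡ r
  parent-of-root-neighbour rv with parent-edge rv
  ... | inj₁ pr≡v = ⊥-elim (adj-irrefl G (subst (Adj G r) (trans (sym pr≡v) parent-root) rv))
  ... | inj₂ pv≡r = pv≡r

module RootedAt {n} {G : Graph n} (connected : Connected G) (acyclic : Acyclic G) (r : Fin n) where
  open DecMembership (_≟_ {n}) using (_∈?_)

  step-towards-root : ∀ v → v ≢ r → Σ (Fin n) λ w → Adj G v w × Σ (Walk G w r) λ p → v ∉ vertices p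
  step-towards-root v v≢r with toPath (connected v r)
  ... | here       , _         , _ = contradiction refl v≢r
  ... | step a p   , v∉p ∷ _   , _ = _ , a , p , All¬⇒¬Any v∉p

  parent : Fin n → Fin n
  parent v with v ≟ r
  ... | yes _   = r
  ... | no  v≢r = proj₁ (step-towards-root v v≢r)

  parent-root : parent r ≡ r
  parent-root with r ≟ r
  ... | yes _   = refl
  ... | no  r≢r = contradiction refl r≢r

  parent-unique : ∀ {v u} → v ≢ r → Adj G v u → (p : Walk G u r) → v ∉ vertices p → parent v ≡ u
  parent-unique {v} v≢r vu p v∉p with v ≟ r
  ... | yes v≡r  = contradiction v≡r v≢r
  ... | no  v≢r′ with w , vw , q , v∉q ← step-towards-root v v≢r′ =
    towards-unique acyclic vw vu q v∉q p v∉p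

  parent-from-path : ∀ {u v} → Adj G u v → (p : Walk G v r) → Unique (vertices p) →
    u ∈ vertices p → parent v ≡ u
  parent-from-path uv here       _          (here refl)  = ⊥-elim (adj-irrefl G uv)
  parent-from-path uv (step _ _) _          (here refl)  = ⊥-elim (adj-irrefl G uv)
  parent-from-path uv (step _ p) (v∉p ∷ _)  (there u∈p)
    with q , q⊆p , _ ← suffix-from p u∈p =
    parent-unique (λ { refl → v∉q (end∈ q) }) (adj-sym G uv) q v∉q
    where
    v∉q = All¬⇒¬Any v∉p ∘ q⊆p

  parent-edge : ∀ {u v} → Adj G u v → parent u ≡ v ⊎ parent v ≡ u
  parent-edge {u} {v} uv with p , up , _ ← toPath (connected v r) with u ∈? vertices p
  ... | yes u∈p = inj₂ (parent-from-path uv p up u∈p)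
  ... | no  u∉p = inj₁ (parent-unique (λ { refl → u∉p (end∈ p) }) uv p u∉p)

rooting : ∀ {n} {G : Graph n} → Connected G → Acyclic G → ∀ r → Rooting G r
rooting connected acyclic r = record { RootedAt connected acyclic r }

module _ {n} {G : Graph n} {r} (ρ : Rooting G r) (S : VSet n) where
  open Rooting ρ

  outside-has-child : TwoDominating G S →
    ∀ {v} → T (not (S v)) → ∃[ w ] T (S w ∧ not (S (parent w))) × parent w ≡ v
  outside-has-child S-dom {v} v∉S
    with a , b , a≢b , va , vb ← count-witness₂ _ (S-dom v (to T-not-≡ v∉S))
    with vaᴬ , Sa ← T-guard {adj G v a} va | vbᴬ , Sb ← T-guard {adj G v b} vb
    with parent-edge vaᴬ | parent-edge vbᴬ
  ... | inj₂ pa≡v | _         = a , from T-∧ (Sa , subst (T ∘ not ∘ S) (sym pa≡v) v∉S) , pa≡v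
  ... | inj₁ _    | inj₂ pb≡v = b , from T-∧ (Sb , subst (T ∘ not ∘ S) (sym pb≡v) v∉S) , pb≡v
  ... | inj₁ pv≡a | inj₁ pv≡b = contradiction (trans (sym pv≡a) pv≡b) a≢b

  -- The first count is the part of S that the child choice of outside-has-child never hits.
  count-parent-in+count-outside≤ : TwoDominating G S →
    count (λ w → S w ∧ S (parent w)) + count (not ∘ S) ≤ count S
  count-parent-in+count-outside≤ S-dom = begin
    count (λ w → S w ∧ S (parent w)) + count (not ∘ S)
      ≤⟨ +-monoʳ-≤ _ (count-≤-image parent (not ∘ S) _ (outside-has-child S-dom)) ⟩
    count (λ w → S w ∧ S (parent w)) + count (λ w → S w ∧ not (S (parent w)))
      ≡⟨ count-split S (S ∘ parent) ⟩
    count S ∎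
    where open ≤-Reasoning

  root-parent-in : T (S r) → T (S r ∧ S (parent r))
  root-parent-in r∈S = from T-∧ (r∈S , subst (T ∘ S) (sym parent-root) r∈S)

module _ {n} {G : Graph n} (connected : Connected G) (acyclic : Acyclic G) where

  dominating-bound : ∀ {S : VSet n} → TwoDominating G S → ∀ {r} → T (S r) →
    suc (count (not ∘ S)) ≤ count S
  dominating-bound {S} S-dom {r} r∈S =
    ≤-trans (+-monoˡ-≤ _ (count-pos (λ w → S w ∧ S (parent w)) (root-parent-in ρ S r∈S)))
            (count-parent-in+count-outside≤ ρ S S-dom)
    where
    ρ = rooting connected acyclic r
    open Rooting ρ

  dominating-bound-edge : ∀ {S : VSet n} → TwoDominating G S → ∀ {s t} → Adj G s t →
    T (S s) → T (S t) → 2 + count (not ∘ S) ≤ count S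
  dominating-bound-edge {S} S-dom {s} {t} st s∈S t∈S =
    ≤-trans (+-monoˡ-≤ _ (count-two (λ w → S w ∧ S (parent w)) s≢t
                           (root-parent-in ρ S s∈S) t-parent-in))
            (count-parent-in+count-outside≤ ρ S S-dom)
    where
    ρ = rooting connected acyclic s
    open Rooting ρ
    s≢t : s ≢ t
    s≢t refl = adj-irrefl G st
    t-parent-in : T (S t ∧ S (parent t))
    t-parent-in = from T-∧ (t∈S , subst (T ∘ S) (sym (parent-of-root-neighbour st)) s∈S)

  dominating-sets-meet : ∀ {S U : VSet n} → TwoDominating G S → TwoDominating G U →
    ∀ {s u} → T (S s) → T (U u) → U ⊆ (not ∘ S) → ⊥
  dominating-sets-meet {S} {U} S-dom U-dom s∈S u∈U U⊆Sᶜ = <-irrefl refl (begin-strict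
    count U          ≤⟨ count-mono U⊆Sᶜ ⟩
    count (not ∘ S)  <⟨ dominating-bound S-dom s∈S ⟩
    count S          ≤⟨ count-mono S⊆Uᶜ ⟩
    count (not ∘ U)  <⟨ dominating-bound U-dom u∈U ⟩
    count U          ∎)
    where
    open ≤-Reasoning
    S⊆Uᶜ : S ⊆ (not ∘ U)
    S⊆Uᶜ v v∈S = not-intro λ v∈U → not-elim (U⊆Sᶜ v v∈U) v∈S

tightness : ∀ {n s x q} → s + x ≡ n → suc x ≤ s → q ≤ x → n ≤ suc (q + q) → x ≤ q × s ≤ suc x
tightness {s = s} {x} {q} s+x≡n 1+x≤s q≤x n≤1+2q = x≤q , +-cancelʳ-≤ x s (suc x) s+x≤1+2x
  where
  s+x≤1+2q : s + x ≤ suc (q + q)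
  s+x≤1+2q = subst (_≤ suc (q + q)) (sym s+x≡n) n≤1+2q
  x≤q : x ≤ q
  x≤q = ≮⇒≥ λ q<x → <⇒≱ (+-mono-< q<x q<x) (≤-pred (≤-trans (+-monoˡ-≤ x 1+x≤s) s+x≤1+2q))
  s+x≤1+2x : s + x ≤ suc x + x
  s+x≤1+2x = ≤-trans s+x≤1+2q (s≤s (+-mono-≤ q≤x q≤x))

double-bound : ∀ {n} q → 2 + (q + q) ≤ n → 2 * (2 + q) ≤ n + 2
double-bound {n} q 2+2q≤n = subst (_≤ n + 2) (sym (double q)) (+-monoˡ-≤ 2 2+2q≤n)
  where
  double : ∀ q → 2 * (2 + q) ≡ 2 + (q + q) + 2
  double = solve-∀

module _ {n} {G : Graph n} (connected : Connected G) (acyclic : Acyclic G)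
         {k} (Θ : TwoCoalitionPartition G k) where
  open TwoCoalitionPartition Θ

  class : Fin k → VSet n
  class = classOf label

  rep : Fin k → Fin n
  rep i = proj₁ (nonempty i)

  label-rep : ∀ i → label (rep i) ≡ i
  label-rep i = proj₂ (nonempty i)

  rep∈class : ∀ i → T (class i (rep i))
  rep∈class i = ≡⇒== (label-rep i)

  class⇒label : ∀ {c v} → T (class c v) → label v ≡ c
  class⇒label {c} {v} = ==⇒≡ {i = label v} {c}

  count-indices≤ : (Q : Fin k → Bool) (U : VSet n) → (∀ {c} → T (Q c) → class c ⊆ U) →
    count Q ≤ count U
  count-indices≤ Q U Q⊆U =
    count-≤-image label Q U λ {c} Qc → rep c , Q⊆U Qc (rep c) (rep∈class c) , label-rep c

  k≡1+others : ∀ (i : Fin k) → k ≡ suc (count (λ c → not (c == i)))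
  k≡1+others i = trans (sym (count-all {k})) (count-remove (λ _ → true) {i} tt)

  dominating-class-bound : ∀ (i : Fin k) → TwoDominating G (class i) → count (class i) ≡ 2 →
    2 * k ≤ n + 2
  dominating-class-bound i i-dom size≡2 = ≤-trans (*-monoʳ-≤ 2 k≤2) (+-monoˡ-≤ 2 2≤n)
    where
    open ≤-Reasoning
    outside≤1 : count (not ∘ class i) ≤ 1
    outside≤1 = ≤-pred (subst (suc (count (not ∘ class i)) ≤_) size≡2
                  (dominating-bound connected acyclic i-dom (rep∈class i)))
    others⊆outside : ∀ {c} → T (not (c == i)) → class c ⊆ (not ∘ class i)
    others⊆outside c≢i v v∈c = subst (λ x → T (not (x == i))) (sym (class⇒label v∈c)) c≢i
    k≤2 : k ≤ 2
    k≤2 = begin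
      k                                  ≡⟨ k≡1+others i ⟩
      suc (count (λ c → not (c == i)))   ≤⟨ s≤s (count-indices≤ _ _ others⊆outside) ⟩
      suc (count (not ∘ class i))        ≤⟨ s≤s outside≤1 ⟩
      2                                  ∎
    2≤n : 2 ≤ n
    2≤n = begin
      2                                        ≡⟨ sym size≡2 ⟩
      count (class i)                          ≤⟨ m≤m+n _ _ ⟩
      count (class i) + count (not ∘ class i)  ≡⟨ count-complement (class i) ⟩
      n                                        ∎

  module Coalition {i j : Fin k} (i≢j : i ≢ j) (S-dom : TwoDominating G (class i ∪ class j)) where

    S : VSet n
    S = class i ∪ class j

    others : Fin k → Bool
    others c = not (c == i) ∧ not (c == j)

    i⊆S : class i ⊆ S
    i⊆S v v∈i = from T-∨ (inj₁ v∈i)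

    j⊆S : class j ⊆ S
    j⊆S v v∈j = from (T-∨ {class i v}) (inj₂ v∈j)

    others-outside : ∀ {c} → T (others c) → class c ⊆ (not ∘ S)
    others-outside {c} c∈ v v∈c with c≢i , c≢j ← to (T-∧ {not (c == i)}) c∈ =
      subst (λ x → T (not ((x == i) ∨ (x == j)))) (sym (class⇒label v∈c))
        (not-∨-intro {c == i} c≢i c≢j)

    k≡2+others : k ≡ 2 + count others
    k≡2+others = trans (k≡1+others i)
      (cong suc (count-remove (λ c → not (c == i)) (≢⇒not== {i = j} {i} (i≢j ∘ sym))))

    2≤count-S : 2 ≤ count S
    2≤count-S = count-two S rep-i≢rep-j (i⊆S _ (rep∈class i)) (j⊆S _ (rep∈class j))
      where
      rep-i≢rep-j : rep i ≢ rep j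
      rep-i≢rep-j e = i≢j (trans (sym (label-rep i)) (trans (cong label e) (label-rep j)))

    others≤outside : count others ≤ count (not ∘ S)
    others≤outside = count-indices≤ others (not ∘ S) others-outside

    -- The case n ≤ 2 |others| + 1: then n = |S| + |V∖S| ≥ 2 |V∖S| + 1 ≥ 2 |others| + 1 is
    -- tight, which the parameters record and the module refutes.
    module Tight (outside≤others : count (not ∘ S) ≤ count others)
                 (S≤1+outside : count S ≤ suc (count (not ∘ S))) where

      S-independent : ∀ {s t} → T (S s) → T (S t) → ¬ Adj G s t
      S-independent s∈S t∈S st =
        <-irrefl refl
          (≤-trans (dominating-bound-edge connected acyclic S-dom st s∈S t∈S) S≤1+outside)

      others-singleton : ∀ {c y} → T (others c) → T (class c y) → y ≡ rep c
      others-singleton {c} {y} c∈ y∈c with y ≟ rep c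
      ... | yes y≡rep = y≡rep
      ... | no  y≢rep = ⊥-elim (<-irrefl refl (begin-strict
        count others
          <⟨ s≤s (count-≤-image label others _ cover) ⟩
        suc (count (λ v → not (S v) ∧ not (v == y)))
          ≡⟨ count-remove (not ∘ S) (others-outside c∈ y y∈c) ⟨
        count (not ∘ S)
          ≤⟨ outside≤others ⟩
        count others ∎))
        where
        open ≤-Reasoning
        cover : ∀ {d} → T (others d) → ∃[ v ] T (not (S v) ∧ not (v == y)) × label v ≡ d
        cover {d} d∈ =
          rep d , from T-∧ (others-outside d∈ _ (rep∈class d) , ≢⇒not== {i = rep d} {y} rep≢y) ,
          label-rep d
          where
          rep≢y : rep d ≢ y
          rep≢y e = y≢rep (trans (sym e) (cong rep d≡c))
            where
            d≡c : d ≡ c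
            d≡c = trans (sym (label-rep d)) (trans (cong label e) (class⇒label y∈c))

      S-class-no-partner : ∀ {c d e} → T (others c) → e ≢ d → class d ⊆ S → class e ⊆ S →
        ¬ TwoDominating G (class c ∪ class d)
      S-class-no-partner {c} {d} {e} c∈ e≢d d⊆S e⊆S cd-dom =
        <⇒≱ (cd-dom (rep e) b∉cd) (count≤1 _ neighbour-is-rep)
        where
        e≢c : e ≢ c
        e≢c refl = not-elim (others-outside c∈ (rep c) (rep∈class c)) (e⊆S (rep c) (rep∈class c))
        b∉cd : (class c ∪ class d) (rep e) ≡ false
        b∉cd = to T-not-≡ (subst (λ x → T (not ((x == c) ∨ (x == d)))) (sym (label-rep e))
                 (not-∨-intro {e == c} (≢⇒not== {i = e} e≢c) (≢⇒not== {i = e} e≢d)))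
        neighbour-is-rep : ∀ {u} → T (if adj G (rep e) u then (class c ∪ class d) u else false) →
          u ≡ rep c
        neighbour-is-rep {u} t with bu , u∈cd ← T-guard {adj G (rep e) u} t
          with to (T-∨ {class c u}) u∈cd
        ... | inj₁ u∈c = others-singleton c∈ u∈c
        ... | inj₂ u∈d = ⊥-elim (S-independent (e⊆S _ (rep∈class e)) (d⊆S u u∈d) bu)

      1≤others : 1 ≤ count others
      1≤others = ≤-pred (≤-trans 2≤count-S (≤-trans S≤1+outside (s≤s outside≤others)))

      absurd : ⊥
      absurd with c , c∈ ← count-witness others 1≤others with good c
      ... | inj₁ (c-dom , _) =
        dominating-sets-meet connected acyclic S-dom c-dom (i⊆S _ (rep∈class i)) (rep∈class c)
          (others-outside c∈)
      ... | inj₂ (d , _ , _ , _ , cd-dom) with d ≟ i | d ≟ j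
      ...   | yes refl | _        = S-class-no-partner c∈ (i≢j ∘ sym) i⊆S j⊆S cd-dom
      ...   | no _     | yes refl = S-class-no-partner c∈ i≢j j⊆S i⊆S cd-dom
      ...   | no d≢i   | no d≢j   =
        dominating-sets-meet connected acyclic S-dom cd-dom (i⊆S _ (rep∈class i))
          (from (T-∨ {class c (rep c)}) (inj₁ (rep∈class c)))
          (∪-⊆ (others-outside c∈) (others-outside d∈))
        where
        d∈ : T (others d)
        d∈ = from T-∧ (≢⇒not== {i = d} d≢i , ≢⇒not== {i = d} d≢j)

    bound : 2 * k ≤ n + 2
    bound with n ≤? suc (count others + count others)
    ... | yes tight
      with outside≤others , S≤1+outside ← tightness (count-complement S)
             (dominating-bound connected acyclic S-dom (i⊆S _ (rep∈class i))) others≤outside tight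
      = ⊥-elim (Tight.absurd outside≤others S≤1+outside)
    ... | no  slack =
      subst (λ k → 2 * k ≤ n + 2) (sym k≡2+others) (double-bound (count others) (≰⇒> slack))

theorem12 : ∀ (n : ℕ) (T : Graph n) → IsTree T →
    ∀ (k : ℕ) → TwoCoalitionPartition T k → 2 * k ≤ n + 2
theorem12 n G (_ , connected , acyclic) zero    Θ = z≤n
theorem12 n G (_ , connected , acyclic) (suc k) Θ with TwoCoalitionPartition.good Θ zero
... | inj₁ (dominating , size≡2) =
  dominating-class-bound connected acyclic Θ zero dominating size≡2
... | inj₂ (j , j≢0 , _ , _ , dominating) =
  Coalition.bound connected acyclic Θ (j≢0 ∘ sym) dominating
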